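{- Let $a$ be an integer with $a\notin\{0,1,-1\}$. Let $\{V_n\}_{n\geq0}$ be defined by $V_0=2$, $V_1=a+2$, $V_{n+1}=(a+2)V_n-(a^2+a+1)V_{n-1}$ for $n\geq1$, and $\{v_n\}_{n\geq0}$ by $v_0=2$, $v_1=2-a$, $v_{n+1}=(2-a)v_n-(a^2-a+1)v_{n-1}$ for $n\geq1$. Then for all $n\geq1$: $$\Delta_6(0,n)=V_n+v_n,$$ $$\Delta_6(1,n)=-\tfrac1aV_n+\tfrac{a^2+a+1}{a}V_{n-1}-\tfrac1av_n+\tfrac{a^2-a+1}{a}v_{n-1},$$ $$\Delta_6(2,n)=-\tfrac{a+1}{a}V_n+\tfrac{a^2+a+1}{a}V_{n-1}-\tfrac{a-1}{a}v_n-\tfrac{a^2-a+1}{a}v_{n-1},$$ $$\Delta_6(3,n)=-V_n+v_n,$$ $$\Delta_6(4,n)=\tfrac1aV_n-\tfrac{a^2+a+1}{a}V_{n-1}-\tfrac1av_n+\tfrac{a^2-a+1}{a}v_{n-1},$$ $$\Delta_6(5,n)=\tfrac{a+1}{a}V_n-\tfrac{a^2+a+1}{a}V_{n-1}-\tfrac{a-1}{a}v_n-\tfrac{a^2-a+1}{a}v_{n-1}.$$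
   Context: For integers $n>0$ and $r$, $\Delta_6(r,n)=6\sum_{0\le k\le n,\ k\equiv r\ (\mathrm{mod}\ 6)}\binom nk a^k-(1+a)^n-(-1)^r(1-a)^n$. -}

module Defs where

open import Data.Nat as ℕ using (ℕ; zero; suc; _%_)
open import Data.Nat.Combinatorics using (_C_)
open import Data.Integer using (ℤ; +_; _+_; _-_; _*_; -_; _^_)
open import Data.Bool using (if_then_else_)
open import Relation.Nullary using (does)

sumTo : ℕ → (ℕ → ℤ) → ℤ
sumTo zero    f = f zero
sumTo (suc n) f = sumTo n f + f (suc n)

Δ₆ : ℤ → ℕ → ℕ → ℤ
Δ₆ a r n =
  + 6 * sumTo n (λ k → if does (k % 6 ℕ.≟ r % 6) then + (n C k) * a ^ k else + 0)
  - (+ 1 + a) ^ n - (- + 1) ^ r * (+ 1 - a) ^ n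

V : ℤ → ℕ → ℤ
V a zero = + 2
V a (suc zero) = a + + 2
V a (suc (suc n)) = (a + + 2) * V a (suc n) - (a * a + a + + 1) * V a n

v : ℤ → ℕ → ℤ
v a zero = + 2
v a (suc zero) = + 2 - a
v a (suc (suc n)) = (+ 2 - a) * v a (suc n) - (a * a - a + + 1) * v a n

{-# OPTIONS --safe #-}
-- Pascal's rule splits a residue-class sum of binomial terms into two neighbouring classes, so
-- Δ₆(r, n+1) = Δ₆(r, n) + a Δ₆(r-1, n), with the residue r read modulo 6; the powers (1+a)ⁿ and
-- (1-a)ⁿ obey the same rule. The right-hand sides, as functions of (Vₙ, Vₙ₋₁, vₙ, vₙ₋₁), satisfy
-- this recurrence too once Vₙ₊₁ and vₙ₊₁ are expanded by their defining recurrences (a polynomial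
-- identity for each r), and both sides agree at n = 1.
module Submission where

open import Defs
open import Data.Nat using (ℕ; suc)
open import Data.Integer using (ℤ; +_; _+_; _-_; _*_; -_)
open import Data.Product using (_×_)
open import Relation.Binary.PropositionalEquality using (_≡_; _≢_)

open import Algebra.Properties.CommutativeSemigroup using (interchange)
open import Data.Bool using (Bool; true; false; if_then_else_)
open import Data.Integer using (_^_)
open import Data.Integer.Properties
  using (pos-+; +-identityʳ; *-zeroʳ; +-assoc; *-distribˡ-+; +-commutativeSemigroup)
open import Data.Integer.Tactic.RingSolver using (solve-∀)
open import Data.Nat as ℕ using (zero; _%_; NonZero; _≟_)
open import Data.Nat.Combinatorics using (_C_; nCk+nC[k+1]≡[n+1]C[k+1]; k>n⇒nCk≡0)
open import Data.Nat.DivMod using (%-distribˡ-+; %-remove-+ˡ)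
open import Data.Nat.Divisibility using (∣-refl)
open import Data.Nat.Properties using (n<1+n; +-suc)
open import Data.Product using (_,_)
open import Function using (_∘_; _⇔_; mk⇔)
open import Relation.Nullary using (does)
open import Relation.Nullary.Decidable using (does-⇔)
open import Relation.Binary.PropositionalEquality using (refl; sym; trans; cong; cong₂; module ≡-Reasoning)

sumTo-cong : ∀ n {f g : ℕ → ℤ} → (∀ k → f k ≡ g k) → sumTo n f ≡ sumTo n g
sumTo-cong zero    f≗g = f≗g 0
sumTo-cong (suc n) f≗g = cong₂ _+_ (sumTo-cong n f≗g) (f≗g (suc n))

sumTo-distrib-+ : ∀ n (f g : ℕ → ℤ) → sumTo n (λ k → f k + g k) ≡ sumTo n f + sumTo n g
sumTo-distrib-+ zero    f g = refl
sumTo-distrib-+ (suc n) f g = trans (cong (_+ (f (suc n) + g (suc n))) (sumTo-distrib-+ n f g))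
  (interchange +-commutativeSemigroup (sumTo n f) (sumTo n g) (f (suc n)) (g (suc n)))

sumTo-distribˡ-* : ∀ n x (f : ℕ → ℤ) → sumTo n (λ k → x * f k) ≡ x * sumTo n f
sumTo-distribˡ-* zero    x f = refl
sumTo-distribˡ-* (suc n) x f = trans (cong (_+ x * f (suc n)) (sumTo-distribˡ-* n x f))
  (sym (*-distribˡ-+ x (sumTo n f) (f (suc n))))

sumTo-shift : ∀ n (f : ℕ → ℤ) → sumTo (suc n) f ≡ f 0 + sumTo n (f ∘ suc)
sumTo-shift zero    f = refl
sumTo-shift (suc n) f = trans (cong (_+ f (suc (suc n))) (sumTo-shift n f))
  (+-assoc (f 0) (sumTo n (f ∘ suc)) (f (suc (suc n))))

+-%-congʳ : ∀ m {n o} d .{{_ : NonZero d}} → n % d ≡ o % d → (m ℕ.+ n) % d ≡ (m ℕ.+ o) % d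
+-%-congʳ m {n} {o} d n≡o = begin
  (m ℕ.+ n) % d          ≡⟨ %-distribˡ-+ m n d ⟩
  (m % d ℕ.+ n % d) % d  ≡⟨ cong (λ x → (m % d ℕ.+ x) % d) n≡o ⟩
  (m % d ℕ.+ o % d) % d  ≡⟨ %-distribˡ-+ m o d ⟨
  (m ℕ.+ o) % d          ∎
  where open ≡-Reasoning

suc-%-≡-⇔ : ∀ d .{{_ : NonZero d}} {m n} → (suc m % d ≡ suc n % d) ⇔ (m % d ≡ n % d)
suc-%-≡-⇔ d@(suc e) {m} {n} = mk⇔ cancel (+-%-congʳ 1 d)
  where
  open ≡-Reasoning
  d+k≡e+[1+k] : ∀ k → d ℕ.+ k ≡ e ℕ.+ suc k
  d+k≡e+[1+k] k = sym (+-suc e k)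
  cancel : suc m % d ≡ suc n % d → m % d ≡ n % d
  cancel h = begin
    m % d                ≡⟨ %-remove-+ˡ m ∣-refl ⟨
    (d ℕ.+ m) % d        ≡⟨ cong (_% d) (d+k≡e+[1+k] m) ⟩
    (e ℕ.+ suc m) % d    ≡⟨ +-%-congʳ e d h ⟩
    (e ℕ.+ suc n) % d    ≡⟨ cong (_% d) (d+k≡e+[1+k] n) ⟨
    (d ℕ.+ n) % d        ≡⟨ %-remove-+ˡ n ∣-refl ⟩
    n % d                ∎

congruentᵇ : (d : ℕ) .{{_ : NonZero d}} → ℕ → ℕ → Bool
congruentᵇ d r k = does (k % d ≟ r % d)

congruentᵇ-suc : ∀ d .{{_ : NonZero d}} r k → congruentᵇ d (suc r) (suc k) ≡ congruentᵇ d r k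
congruentᵇ-suc d r k = does-⇔ (suc-%-≡-⇔ d) (suc k % d ≟ suc r % d) (k % d ≟ r % d)

module _ (a : ℤ) where

  filteredBinomialSum : (ℕ → Bool) → ℕ → ℤ
  filteredBinomialSum P n = sumTo n (λ k → if P k then + (n C k) * a ^ k else + 0)

  filteredBinomialSum-suc : ∀ P n →
    filteredBinomialSum P (suc n) ≡ filteredBinomialSum P n + a * filteredBinomialSum (P ∘ suc) n
  filteredBinomialSum-suc P n = begin
      sumTo (suc n) (term (suc n))
    ≡⟨ sumTo-shift n (term (suc n)) ⟩
      term n 0 + sumTo n (term (suc n) ∘ suc)
    ≡⟨ cong (_+_ (term n 0)) (sumTo-cong n pascal) ⟩
      term n 0 + sumTo n (λ k → a * shifted k + term n (suc k))
    ≡⟨ cong (_+_ (term n 0)) (sumTo-distrib-+ n (λ k → a * shifted k) (term n ∘ suc)) ⟩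
      term n 0 + (sumTo n (λ k → a * shifted k) + sumTo n (term n ∘ suc))
    ≡⟨ cong (λ x → term n 0 + (x + sumTo n (term n ∘ suc))) (sumTo-distribˡ-* n a shifted) ⟩
      term n 0 + (a * S′ + sumTo n (term n ∘ suc))
    ≡⟨ regroup (term n 0) (a * S′) (sumTo n (term n ∘ suc)) ⟩
      (term n 0 + sumTo n (term n ∘ suc)) + a * S′
    ≡⟨ cong (_+ a * S′) (sym (sumTo-shift n (term n))) ⟩
      sumTo n (term n) + term n (suc n) + a * S′
    ≡⟨ cong (λ x → sumTo n (term n) + x + a * S′) beyond-top ⟩
      sumTo n (term n) + + 0 + a * S′
    ≡⟨ cong (_+ a * S′) (+-identityʳ (sumTo n (term n))) ⟩
      sumTo n (term n) + a * S′
    ∎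
    where
    open ≡-Reasoning
    term : ℕ → ℕ → ℤ
    term m k = if P k then + (m C k) * a ^ k else + 0
    shifted : ℕ → ℤ
    shifted k = if P (suc k) then + (n C k) * a ^ k else + 0
    S′ : ℤ
    S′ = filteredBinomialSum (P ∘ suc) n

    regroup : ∀ x y z → x + (y + z) ≡ (x + z) + y
    regroup = solve-∀

    pascal : ∀ k → term (suc n) (suc k) ≡ a * shifted k + term n (suc k)
    pascal k with P (suc k)
    ... | false = sym (trans (+-identityʳ (a * + 0)) (*-zeroʳ a))
    ... | true  rewrite sym (nCk+nC[k+1]≡[n+1]C[k+1] n k) | pos-+ (n C k) (n C suc k) =
      split (+ (n C k)) (+ (n C suc k)) a (a ^ k)
      where
      split : ∀ x y a p → (x + y) * (a * p) ≡ a * (x * p) + y * (a * p)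
      split = solve-∀

    beyond-top : term n (suc n) ≡ + 0
    beyond-top with P (suc n)
    ... | false = refl
    ... | true rewrite k>n⇒nCk≡0 (n<1+n n) = refl

  filteredBinomialSum-cong : ∀ {P Q} n → (∀ k → P k ≡ Q k) → filteredBinomialSum P n ≡ filteredBinomialSum Q n
  filteredBinomialSum-cong n P≗Q =
    sumTo-cong n (λ k → cong (λ b → if b then + (n C k) * a ^ k else + 0) (P≗Q k))

  residueSum-suc : ∀ d .{{_ : NonZero d}} r n →
    filteredBinomialSum (congruentᵇ d (suc r)) (suc n)
    ≡ filteredBinomialSum (congruentᵇ d (suc r)) n + a * filteredBinomialSum (congruentᵇ d r) n
  residueSum-suc d r n = trans (filteredBinomialSum-suc (congruentᵇ d (suc r)) n)
    (cong (λ S → filteredBinomialSum (congruentᵇ d (suc r)) n + a * S)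
          (filteredBinomialSum-cong n (congruentᵇ-suc d r)))

Δ₆-suc : ∀ a r n → Δ₆ a (suc r) (suc n) ≡ Δ₆ a (suc r) n + a * Δ₆ a r n
Δ₆-suc a r n = begin
    Δ₆ a (suc r) (suc n)
  ≡⟨ cong (λ S → + 6 * S - (+ 1 + a) ^ suc n - (- + 1) ^ suc r * (+ 1 - a) ^ suc n) (residueSum-suc a 6 r n) ⟩
    + 6 * (X + a * Y) - (+ 1 + a) ^ suc n - (- + 1) ^ suc r * (+ 1 - a) ^ suc n
  ≡⟨ regroup a X Y ((+ 1 + a) ^ n) ((+ 1 - a) ^ n) ((- + 1) ^ r) ⟩
    Δ₆ a (suc r) n + a * Δ₆ a r n
  ∎
  where
  open ≡-Reasoning
  X = filteredBinomialSum a (congruentᵇ 6 (suc r)) n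
  Y = filteredBinomialSum a (congruentᵇ 6 r) n
  regroup : ∀ a X Y P Q s →
    + 6 * (X + a * Y) - (+ 1 + a) * P - (- + 1 * s) * ((+ 1 - a) * Q)
    ≡ (+ 6 * X - P - (- + 1 * s) * Q) + a * (+ 6 * Y - P - s * Q)
  regroup = solve-∀

*-Δ₆-suc : ∀ a r n → a * Δ₆ a (suc r) (suc n) ≡ a * Δ₆ a (suc r) n + a * (a * Δ₆ a r n)
*-Δ₆-suc a r n = trans (cong (a *_) (Δ₆-suc a r n)) (*-distribˡ-+ a (Δ₆ a (suc r) n) (a * Δ₆ a r n))

-- The constants on the left are the values Δ₆ a r 0 = 6[r ≡ 0] - 1 - (-1)ʳ, which reduce to numerals.
closedForm₀-base : ∀ a → + 4 + a * + 0 ≡ (a + + 2) + (+ 2 - a)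
closedForm₀-base = solve-∀

closedForm₁-base : ∀ a →
  a * + 0 + a * (a * + 4) ≡ - (a + + 2) + (a * a + a + + 1) * + 2 - (+ 2 - a) + (a * a - a + + 1) * + 2
closedForm₁-base = solve-∀

closedForm₂-base : ∀ a →
  a * - + 2 + a * (a * + 0)
  ≡ - ((a + + 1) * (a + + 2)) + (a * a + a + + 1) * + 2 - (a - + 1) * (+ 2 - a) - (a * a - a + + 1) * + 2
closedForm₂-base = solve-∀

closedForm₃-base : ∀ a → + 0 + a * - + 2 ≡ - (a + + 2) + (+ 2 - a)
closedForm₃-base = solve-∀

closedForm₄-base : ∀ a →
  a * - + 2 + a * (a * + 0) ≡ (a + + 2) - (a * a + a + + 1) * + 2 - (+ 2 - a) + (a * a - a + + 1) * + 2
closedForm₄-base = solve-∀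

closedForm₅-base : ∀ a →
  a * + 0 + a * (a * - + 2)
  ≡ (a + + 1) * (a + + 2) - (a * a + a + + 1) * + 2 - (a - + 1) * (+ 2 - a) - (a * a - a + + 1) * + 2
closedForm₅-base = solve-∀

closedForm₀-step : ∀ a V₁ V₀ w₁ w₀ →
  (V₁ + w₁) + ((a + + 1) * V₁ - (a * a + a + + 1) * V₀ - (a - + 1) * w₁ - (a * a - a + + 1) * w₀)
  ≡ ((a + + 2) * V₁ - (a * a + a + + 1) * V₀) + ((+ 2 - a) * w₁ - (a * a - a + + 1) * w₀)
closedForm₀-step = solve-∀

closedForm₁-step : ∀ a V₁ V₀ w₁ w₀ →
  (- V₁ + (a * a + a + + 1) * V₀ - w₁ + (a * a - a + + 1) * w₀) + a * (a * (V₁ + w₁))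
  ≡ - ((a + + 2) * V₁ - (a * a + a + + 1) * V₀) + (a * a + a + + 1) * V₁
    - ((+ 2 - a) * w₁ - (a * a - a + + 1) * w₀) + (a * a - a + + 1) * w₁
closedForm₁-step = solve-∀

closedForm₂-step : ∀ a V₁ V₀ w₁ w₀ →
  (- ((a + + 1) * V₁) + (a * a + a + + 1) * V₀ - (a - + 1) * w₁ - (a * a - a + + 1) * w₀)
    + a * (- V₁ + (a * a + a + + 1) * V₀ - w₁ + (a * a - a + + 1) * w₀)
  ≡ - ((a + + 1) * ((a + + 2) * V₁ - (a * a + a + + 1) * V₀)) + (a * a + a + + 1) * V₁
    - (a - + 1) * ((+ 2 - a) * w₁ - (a * a - a + + 1) * w₀) - (a * a - a + + 1) * w₁
closedForm₂-step = solve-∀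

closedForm₃-step : ∀ a V₁ V₀ w₁ w₀ →
  (- V₁ + w₁) + (- ((a + + 1) * V₁) + (a * a + a + + 1) * V₀ - (a - + 1) * w₁ - (a * a - a + + 1) * w₀)
  ≡ - ((a + + 2) * V₁ - (a * a + a + + 1) * V₀) + ((+ 2 - a) * w₁ - (a * a - a + + 1) * w₀)
closedForm₃-step = solve-∀

closedForm₄-step : ∀ a V₁ V₀ w₁ w₀ →
  (V₁ - (a * a + a + + 1) * V₀ - w₁ + (a * a - a + + 1) * w₀) + a * (a * (- V₁ + w₁))
  ≡ ((a + + 2) * V₁ - (a * a + a + + 1) * V₀) - (a * a + a + + 1) * V₁
    - ((+ 2 - a) * w₁ - (a * a - a + + 1) * w₀) + (a * a - a + + 1) * w₁
closedForm₄-step = solve-∀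

closedForm₅-step : ∀ a V₁ V₀ w₁ w₀ →
  ((a + + 1) * V₁ - (a * a + a + + 1) * V₀ - (a - + 1) * w₁ - (a * a - a + + 1) * w₀)
    + a * (V₁ - (a * a + a + + 1) * V₀ - w₁ + (a * a - a + + 1) * w₀)
  ≡ (a + + 1) * ((a + + 2) * V₁ - (a * a + a + + 1) * V₀) - (a * a + a + + 1) * V₁
    - (a - + 1) * ((+ 2 - a) * w₁ - (a * a - a + + 1) * w₀) - (a * a - a + + 1) * w₁
closedForm₅-step = solve-∀

ClosedForms : ℤ → ℕ → Set
ClosedForms a m =
    (Δ₆ a 0 (suc m) ≡ V a (suc m) + v a (suc m))
  × (a * Δ₆ a 1 (suc m) ≡ - V a (suc m) + (a * a + a + + 1) * V a m - v a (suc m) + (a * a - a + + 1) * v a m)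
  × (a * Δ₆ a 2 (suc m) ≡ - ((a + + 1) * V a (suc m)) + (a * a + a + + 1) * V a m - (a - + 1) * v a (suc m) - (a * a - a + + 1) * v a m)
  × (Δ₆ a 3 (suc m) ≡ - V a (suc m) + v a (suc m))
  × (a * Δ₆ a 4 (suc m) ≡ V a (suc m) - (a * a + a + + 1) * V a m - v a (suc m) + (a * a - a + + 1) * v a m)
  × (a * Δ₆ a 5 (suc m) ≡ (a + + 1) * V a (suc m) - (a * a + a + + 1) * V a m - (a - + 1) * v a (suc m) - (a * a - a + + 1) * v a m)

-- Residue 0 is reached from residue 5 through Δ₆ a 6, which is definitionally Δ₆ a 0.
closedForms : ∀ a m → ClosedForms a m
closedForms a zero =
    trans (Δ₆-suc a 5 0) (closedForm₀-base a)
  , trans (*-Δ₆-suc a 0 0) (closedForm₁-base a)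
  , trans (*-Δ₆-suc a 1 0) (closedForm₂-base a)
  , trans (Δ₆-suc a 2 0) (closedForm₃-base a)
  , trans (*-Δ₆-suc a 3 0) (closedForm₄-base a)
  , trans (*-Δ₆-suc a 4 0) (closedForm₅-base a)
closedForms a (suc m) with closedForms a m
... | h₀ , h₁ , h₂ , h₃ , h₄ , h₅ =
    trans (Δ₆-suc a 5 (suc m)) (trans (cong₂ _+_ h₀ h₅) (closedForm₀-step a V₁ V₀ w₁ w₀))
  , trans (*-Δ₆-suc a 0 (suc m)) (trans (cong₂ (λ x y → x + a * (a * y)) h₁ h₀) (closedForm₁-step a V₁ V₀ w₁ w₀))
  , trans (*-Δ₆-suc a 1 (suc m)) (trans (cong₂ (λ x y → x + a * y) h₂ h₁) (closedForm₂-step a V₁ V₀ w₁ w₀))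
  , trans (Δ₆-suc a 2 (suc m)) (trans (cong₂ _+_ h₃ h₂) (closedForm₃-step a V₁ V₀ w₁ w₀))
  , trans (*-Δ₆-suc a 3 (suc m)) (trans (cong₂ (λ x y → x + a * (a * y)) h₄ h₃) (closedForm₄-step a V₁ V₀ w₁ w₀))
  , trans (*-Δ₆-suc a 4 (suc m)) (trans (cong₂ (λ x y → x + a * y) h₅ h₄) (closedForm₅-step a V₁ V₀ w₁ w₀))
  where
  V₁ = V a (suc m)
  V₀ = V a m
  w₁ = v a (suc m)
  w₀ = v a m

theorem6p1 : (a : ℤ) → a ≢ + 0 → a ≢ + 1 → a ≢ - + 1 → (m : ℕ) →
    (Δ₆ a 0 (suc m) ≡ V a (suc m) + v a (suc m))
    × (a * Δ₆ a 1 (suc m) ≡ - V a (suc m) + (a * a + a + + 1) * V a m - v a (suc m) + (a * a - a + + 1) * v a m)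
    × (a * Δ₆ a 2 (suc m) ≡ - ((a + + 1) * V a (suc m)) + (a * a + a + + 1) * V a m - (a - + 1) * v a (suc m) - (a * a - a + + 1) * v a m)
    × (Δ₆ a 3 (suc m) ≡ - V a (suc m) + v a (suc m))
    × (a * Δ₆ a 4 (suc m) ≡ V a (suc m) - (a * a + a + + 1) * V a m - v a (suc m) + (a * a - a + + 1) * v a m)
    × (a * Δ₆ a 5 (suc m) ≡ (a + + 1) * V a (suc m) - (a * a + a + + 1) * V a m - (a - + 1) * v a (suc m) - (a * a - a + + 1) * v a m)
-- The identities are multiplied through by a, so they hold for every integer a.
theorem6p1 a _ _ _ = closedForms a
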